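{- Let $G$ and $H$ be two nontrivial connected graphs such that the strong product $G\boxtimes H$ is not complete. Then $tpc(G\boxtimes H)=3$.
   Context: All graphs are simple, finite and undirected; nontrivial means having at least two vertices. The strong product $G\boxtimes H$ has vertex set $V(G)\times V(H)$, with $(g,h)$ adjacent to $(g',h')$ iff either ($gg'\in E(G)$ and $h=h'$), or ($g=g'$ and $hh'\in E(H)$), or ($gg'\in E(G)$ and $hh'\in E(H)$). A graph is total-colored if all its vertices and edges are assigned colors. A path in a total-colored graph is a total proper path if (i) any two adjacent edges on the path differ in color, (ii) any two adjacent internal vertices of the path differ in color, and (iii) every internal vertex of the path differs in color from the edges of the path incident with it. A total-colored graph is total-proper connected if any two vertices are joined by a total proper path. For a connected graph $G$, $tpc(G)$ is the smallest number of colors in a total-coloring making $G$ total-proper connected. -}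

module Defs where

open import Data.Nat using (ℕ; _<_; _≤_)
open import Data.Fin using (Fin)
open import Data.List using (List; []; _∷_; head; last)
open import Data.List.Relation.Unary.Unique.Propositional using (Unique)
open import Data.Maybe using (Maybe; just)
open import Data.Product using (Σ; _×_; _,_; ∃; ∃-syntax)
open import Data.Sum using (_⊎_; inj₁; inj₂)
open import Data.Unit using (⊤)
open import Relation.Nullary using (¬_)
open import Relation.Binary.PropositionalEquality using (_≡_; _≢_; refl; sym)

-- A simple graph on vertex type V: symmetric irreflexive adjacency relation.
-- Finite graphs are obtained by taking V = Fin n.
record Graph (V : Set) : Set₁ where
  field
    Adj    : V → V → Set
    symAdj : ∀ {u v} → Adj u v → Adj v u
    irrefl : ∀ v → ¬ Adj v v
open Graph public

_⊠_ : ∀ {V W} → Graph V → Graph W → Graph (V × W)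
_⊠_ {V} {W} G H = record { Adj = A ; symAdj = s ; irrefl = i }
  where
  A : V × W → V × W → Set
  A (g , h) (g' , h') =
    (Adj G g g' × h ≡ h') ⊎ ((g ≡ g' × Adj H h h') ⊎ (Adj G g g' × Adj H h h'))
  s : ∀ {u v} → A u v → A v u
  s (inj₁ (a , e)) = inj₁ (symAdj G a , sym e)
  s (inj₂ (inj₁ (e , b))) = inj₂ (inj₁ (sym e , symAdj H b))
  s (inj₂ (inj₂ (a , b))) = inj₂ (inj₂ (symAdj G a , symAdj H b))
  i : ∀ v → ¬ A v v
  i (g , h) (inj₁ (a , _)) = irrefl G g a
  i (g , h) (inj₂ (inj₁ (_ , b))) = irrefl H h b
  i (g , h) (inj₂ (inj₂ (a , _))) = irrefl G g a

Pairs : ∀ {V : Set} → (V → V → Set) → List V → Set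
Pairs P [] = ⊤
Pairs P (a ∷ []) = ⊤
Pairs P (a ∷ b ∷ r) = P a b × Pairs P (b ∷ r)

Triples : ∀ {V : Set} → (V → V → V → Set) → List V → Set
Triples P [] = ⊤
Triples P (a ∷ []) = ⊤
Triples P (a ∷ b ∷ []) = ⊤
Triples P (a ∷ b ∷ c ∷ r) = P a b c × Triples P (b ∷ c ∷ r)

Quads : ∀ {V : Set} → (V → V → V → V → Set) → List V → Set
Quads P [] = ⊤
Quads P (a ∷ []) = ⊤
Quads P (a ∷ b ∷ []) = ⊤
Quads P (a ∷ b ∷ c ∷ []) = ⊤
Quads P (a ∷ b ∷ c ∷ d ∷ r) = P a b c d × Quads P (b ∷ c ∷ d ∷ r)

IsPath : ∀ {V} → Graph V → V → V → List V → Set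
IsPath G x y p = head p ≡ just x × last p ≡ just y × Unique p × Pairs (Adj G) p

Connected : ∀ {V} → Graph V → Set
Connected {V} G = ∀ (x y : V) → ∃[ p ] IsPath G x y p

-- A total colouring with (at most) k colours: colours of vertices and of edges.
-- The edge colour is given as a symmetric function on pairs of vertices;
-- only its values on edges matter.
record TotalColoring {V} (G : Graph V) (k : ℕ) : Set where
  field
    vcol    : V → Fin k
    ecol    : V → V → Fin k
    ecolSym : ∀ u v → ecol u v ≡ ecol v u
open TotalColoring public

-- Total proper path: (i) adjacent edges differ, (iii) each internal vertex differs
-- from its two incident path edges (consecutive triples a b c, b internal);
-- (ii) adjacent internal vertices differ (consecutive quadruples a b c d).
IsTotalProperPath : ∀ {V} {G : Graph V} {k} → TotalColoring G k → V → V → List V → Set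
IsTotalProperPath {G = G} c x y p =
  IsPath G x y p
  × Triples (λ a b d → ecol c a b ≢ ecol c b d
                     × vcol c b ≢ ecol c a b
                     × vcol c b ≢ ecol c b d) p
  × Quads (λ a b d e → vcol c b ≢ vcol c d) p

TotalProperConnected : ∀ {V} {G : Graph V} {k} → TotalColoring G k → Set
TotalProperConnected {V} c = ∀ (x y : V) → x ≢ y → ∃[ p ] IsTotalProperPath c x y p

TPCColorable : ∀ {V} → Graph V → ℕ → Set
TPCColorable G k = Σ (TotalColoring G k) TotalProperConnected

TpcIs : ∀ {V} → Graph V → ℕ → Set
TpcIs G n = TPCColorable G n × (∀ k → k < n → ¬ TPCColorable G k)

IsComplete : ∀ {V} → Graph V → Set
IsComplete {V} G = ∀ (u v : V) → u ≢ v → Adj G u v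

-- On a total proper path with at least three vertices the first
-- edge, the second vertex and the second edge carry three distinct colours, so
-- with fewer than three colours every two distinct vertices must be adjacent.
--
-- Give G and H rooted spanning trees and 2-colour their vertices
-- by the parity of the depth ("side").  Colour a vertex (g , h) of G ⊠ H by the
-- number of its coordinates on side true (0, 1 or 2) and an edge by the third
-- colour missing at its ends.  Call an edge u → v ascending when the colour of
-- v is the successor of that of u modulo 3.  Any path made of ascending edges
-- is total proper, since its vertex colours run through 0, 1, 2 cyclically.
-- For a tree edge g g' of G and a tree edge h h' of H the four vertices
-- {g, g'} × {h, h'} form a K4 coloured 0, 1, 1, 2 whose ascending edges
-- connect it strongly; chaining such blocks along the two trees makes the
-- ascending digraph strongly connected.  Finally every ascending walk can be
-- shortened to an ascending path by removing cycles.
module Submission where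

open import Defs
open import Data.Nat using (ℕ; zero; suc; _≤_; _<_; z≤n; s≤s)
open import Data.Nat.Properties using (≤-refl; ≤-trans; n≤1+n; ≤-pred)
open import Data.Fin using (Fin; zero; suc)
import Data.Fin as Fin
open import Data.Fin.Properties using (_≟_; pigeonhole)
open import Data.Bool using (Bool; true; false; not)
open import Data.List using (List; []; _∷_; head; last; length; filter; concatMap; allFin)
open import Data.List.Relation.Unary.Any using (here; there; satisfied)
open import Data.List.Relation.Unary.All using ([]; _∷_)
open import Data.List.Relation.Unary.All.Properties.Core using (¬Any⇒All¬)
open import Data.List.Relation.Unary.AllPairs using ([]; _∷_)
open import Data.List.Relation.Unary.Unique.Propositional using (Unique)
open import Data.List.Membership.Propositional using (_∈_; lose)
open import Data.List.Membership.Propositional.Properties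
  using (∈-filter⁺; ∈-filter⁻; ∈-concatMap⁺; ∈-concatMap⁻; ∈-allFin)
open import Data.List.Extrema.Nat using (argmin; argmin-sel; f[argmin]≤v⁺)
open import Data.Maybe using (just)
open import Data.Maybe.Properties using (just-injective)
import Data.Maybe.Properties as Maybe
open import Data.Product using (Σ; _×_; _,_; proj₁; proj₂)
import Data.Product.Properties as Product
open import Data.Sum using (_⊎_; inj₁; inj₂)
open import Data.Empty using (⊥; ⊥-elim)
open import Relation.Nullary using (¬_; Dec; yes; no)
open import Relation.Binary.Definitions using (DecidableEquality)
open import Relation.Binary.PropositionalEquality
  using (_≡_; _≢_; refl; sym; trans; cong; cong₂; subst)
open import Relation.Binary.Construct.Closure.ReflexiveTransitive using (Star; ε; _◅_; _◅◅_)

pairs-map : ∀ {A : Set} {P Q : A → A → Set} → (∀ {u v} → P u v → Q u v) →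
            ∀ l → Pairs P l → Pairs Q l
pairs-map f [] _ = _
pairs-map f (a ∷ []) _ = _
pairs-map f (a ∷ b ∷ l) (p , ps) = f p , pairs-map f (b ∷ l) ps

pairs-tail : ∀ {A : Set} {P : A → A → Set} {a : A} l → Pairs P (a ∷ l) → Pairs P l
pairs-tail [] _ = _
pairs-tail (_ ∷ _) (_ , ps) = ps

module LoopErasure {A : Set} (_≟A_ : DecidableEquality A) where

  open import Data.List.Membership.DecPropositional _≟A_ using (_∈?_)

  fromFirst : A → List A → List A
  fromFirst x [] = []
  fromFirst x (y ∷ ys) with x ≟A y
  ... | yes _ = y ∷ ys
  ... | no _ = fromFirst x ys

  fromFirst-head : ∀ {x} ys → x ∈ ys → head (fromFirst x ys) ≡ just x
  fromFirst-head {x} (y ∷ ys) x∈ with x ≟A y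
  ... | yes x≡y = cong just (sym x≡y)
  fromFirst-head (y ∷ ys) (here x≡y) | no x≢y = ⊥-elim (x≢y x≡y)
  fromFirst-head (y ∷ ys) (there x∈) | no _ = fromFirst-head ys x∈

  fromFirst-last : ∀ {x} ys → x ∈ ys → last (fromFirst x ys) ≡ last ys
  fromFirst-last {x} (y ∷ ys) x∈ with x ≟A y
  ... | yes _ = refl
  fromFirst-last (y ∷ ys) (here x≡y) | no x≢y = ⊥-elim (x≢y x≡y)
  fromFirst-last (y ∷ (z ∷ zs)) (there x∈) | no _ = fromFirst-last (z ∷ zs) x∈

  fromFirst-unique : ∀ x ys → Unique ys → Unique (fromFirst x ys)
  fromFirst-unique x [] u = u
  fromFirst-unique x (y ∷ ys) u with x ≟A y
  fromFirst-unique x (y ∷ ys) u | yes _ = u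
  fromFirst-unique x (y ∷ ys) (_ ∷ u) | no _ = fromFirst-unique x ys u

  fromFirst-pairs : ∀ {S : A → A → Set} x ys → Pairs S ys → Pairs S (fromFirst x ys)
  fromFirst-pairs x [] ps = ps
  fromFirst-pairs x (y ∷ ys) ps with x ≟A y
  ... | yes _ = ps
  ... | no _ = fromFirst-pairs x ys (pairs-tail ys ps)

  -- Every walk along S from x to y contains a path along S from x to y:
  -- prepend the first vertex, or cut back to its earlier occurrence.
  walk⇒path : ∀ {S : A → A → Set} {x y} → Star S x y →
    Σ (List A) λ l → head l ≡ just x × last l ≡ just y × Unique l × Pairs S l
  walk⇒path {x = x} ε = x ∷ [] , refl , refl , [] ∷ [] , _
  walk⇒path {x = x} (s ◅ w) with walk⇒path w
  ... | l , hd , lt , u , ps with x ∈? l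
  ...   | yes x∈l = fromFirst x l , fromFirst-head l x∈l , trans (fromFirst-last l x∈l) lt ,
                    fromFirst-unique x l u , fromFirst-pairs x l ps
  walk⇒path {x = x} (s ◅ w) | (z ∷ l) , refl , lt , u , ps | no x∉l =
    x ∷ z ∷ l , refl , lt , ¬Any⇒All¬ (z ∷ l) x∉l ∷ u , s , ps

-- A spanning tree of G rooted at r, given by a parent map that moves along
-- edges of G and strictly decreases a rank until the root is reached.
record RootedTree {V : Set} (G : Graph V) (r : V) : Set where
  field
    parent      : V → V
    rank        : V → ℕ
    parent-adj  : ∀ {x} → x ≢ r → Adj G x (parent x)
    rank-parent : ∀ {x} → x ≢ r → rank (parent x) < rank x

record AltEdge {V : Set} (G : Graph V) (side : V → Bool) : Set where
  field
    lo hi   : V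
    lo-hi   : Adj G lo hi
    lo-side : side lo ≡ false
    hi-side : side hi ≡ true
open AltEdge

Ends : ∀ {V} {G : Graph V} {side : V → Bool} → AltEdge G side → V → Set
Ends e x = x ≡ lo e ⊎ x ≡ hi e

orient : ∀ {V} {G : Graph V} {side : V → Bool} {x y} → Adj G x y → side x ≡ not (side y) →
         Σ (AltEdge G side) λ e → Ends e x × Ends e y
orient {G = G} {side} {x} {y} xy sx with side y in sy
... | true = record { lo = x ; hi = y ; lo-hi = xy ; lo-side = sx ; hi-side = sy } , inj₁ refl , inj₂ refl
... | false = record { lo = y ; hi = x ; lo-hi = symAdj G xy ; lo-side = sy ; hi-side = sx } , inj₂ refl , inj₁ refl

module RootedTreeFacts {V : Set} (_≟V_ : DecidableEquality V) {G : Graph V} {r : V}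
                       (T : RootedTree G r) where
  open RootedTree T

  induction : (P : V → Set) → P r → (∀ x → x ≢ r → P (parent x) → P x) → ∀ x → P x
  induction P base step x = go (rank x) x ≤-refl
    where
    go : ∀ k x → rank x ≤ k → P x
    go k x _ with x ≟V r
    ... | yes refl = base
    go zero x rx≤0 | no x≢r with ≤-trans (rank-parent x≢r) rx≤0
    ... | ()
    go (suc k) x rx≤k | no x≢r = step x x≢r (go k (parent x) (≤-pred (≤-trans (rank-parent x≢r) rx≤k)))

  -- Parity of the depth, computed with k steps of fuel; it is exact as soon
  -- as the fuel reaches the rank.
  sideWithin : ℕ → V → Bool
  sideWithin k x with x ≟V r
  ... | yes _ = false
  sideWithin zero x | no _ = false
  sideWithin (suc k) x | no _ = not (sideWithin k (parent x))

  sideWithin-stable : ∀ k k' x → rank x ≤ k → rank x ≤ k' → sideWithin k x ≡ sideWithin k' x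
  sideWithin-stable k k' x _ _ with x ≟V r
  ... | yes _ = refl
  sideWithin-stable zero k' x rx≤0 _ | no x≢r with ≤-trans (rank-parent x≢r) rx≤0
  ... | ()
  sideWithin-stable (suc k) zero x _ rx≤0 | no x≢r with ≤-trans (rank-parent x≢r) rx≤0
  ... | ()
  sideWithin-stable (suc k) (suc k') x rx≤k rx≤k' | no x≢r =
    cong not (sideWithin-stable k k' (parent x) (below rx≤k) (below rx≤k'))
    where
    below : ∀ {j} → rank x ≤ suc j → rank (parent x) ≤ j
    below rx≤j = ≤-pred (≤-trans (rank-parent x≢r) rx≤j)

  side : V → Bool
  side x = sideWithin (rank x) x

  -- Tree edges join the two sides: one more unit of fuel unfolds sideWithin
  -- at x into the side of its parent.
  side-parent : ∀ {x} → x ≢ r → side x ≡ not (side (parent x))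
  side-parent {x} x≢r with x ≟V r | sideWithin-stable (rank x) (suc (rank x)) x ≤-refl (n≤1+n _)
  ... | yes x≡r | _ = ⊥-elim (x≢r x≡r)
  ... | no _ | stable = trans stable (cong not (sideWithin-stable (rank x) (rank (parent x)) (parent x)
                                                  (≤-trans (n≤1+n _) (rank-parent x≢r)) ≤-refl))

  tree-edge : ∀ {x} → x ≢ r → Σ (AltEdge G side) λ e → Ends e x × Ends e (parent x)
  tree-edge x≢r = orient (parent-adj x≢r) (side-parent x≢r)

  child-of-root : ∀ {c} → c ≢ r → Σ V λ d → d ≢ r × parent d ≡ r
  child-of-root {c} = induction (λ x → x ≢ r → Σ V λ d → d ≢ r × parent d ≡ r) (λ r≢r → ⊥-elim (r≢r refl))
    (λ x x≢r ih _ → climb x x≢r ih) c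
    where
    climb : ∀ x → x ≢ r → (parent x ≢ r → Σ V λ d → d ≢ r × parent d ≡ r) → Σ V λ d → d ≢ r × parent d ≡ r
    climb x x≢r ih with parent x ≟V r
    ... | yes px≡r = x , x≢r , px≡r
    ... | no px≢r = ih px≢r

  alt-edge-at : ∀ {c} → c ≢ r → ∀ x → Σ (AltEdge G side) λ e → Ends e x
  alt-edge-at c≢r x with x ≟V r
  ... | no x≢r = let e , ex , _ = tree-edge x≢r in e , ex
  ... | yes refl with child-of-root c≢r
  ...   | d , d≢r , pd≡r = let e , _ , epd = tree-edge d≢r in e , subst (Ends e) pd≡r epd

suffixes : ∀ {A : Set} → List A → List (List A)
suffixes [] = []
suffixes (a ∷ l) = (a ∷ l) ∷ suffixes l

self-suffix : ∀ {A : Set} {w : List A} {x} → head w ≡ just x → w ∈ suffixes w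
self-suffix {w = a ∷ l} _ = here refl

suffix-last : ∀ {A : Set} {c : List A} w → c ∈ suffixes w → last c ≡ last w
suffix-last (a ∷ l) (here refl) = refl
suffix-last (a ∷ b ∷ l) (there c∈) = suffix-last (b ∷ l) c∈

suffix-pairs : ∀ {A : Set} {S : A → A → Set} {c} w → c ∈ suffixes w → Pairs S w → Pairs S c
suffix-pairs (a ∷ l) (here refl) ps = ps
suffix-pairs (a ∷ b ∷ l) (there c∈) (_ , ps) = suffix-pairs (b ∷ l) c∈ ps

suffix-tail : ∀ {A : Set} {a b : A} {l} w → (a ∷ b ∷ l) ∈ suffixes w → (b ∷ l) ∈ suffixes w
suffix-tail (a ∷ b ∷ l) (here refl) = there (here refl)
suffix-tail (a ∷ l) (there c∈) = there (suffix-tail l c∈)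

-- Fix a path to r from every vertex; among all suffixes of these paths let
-- best x be a shortest one starting at x.  Its second vertex is the parent of
-- x: the rest of best x is a suffix starting there, so the parent's best
-- suffix is strictly shorter.
module TreeConstruction {n : ℕ} (G : Graph (Fin n)) (r : Fin n) (connected : Connected G) where

  pathTo : Fin n → List (Fin n)
  pathTo z = proj₁ (connected z r)

  candidates : List (List (Fin n))
  candidates = concatMap (λ z → suffixes (pathTo z)) (allFin n)

  candidate : ∀ {c} z → c ∈ suffixes (pathTo z) → c ∈ candidates
  candidate z c∈ = ∈-concatMap⁺ (λ z → suffixes (pathTo z)) (lose (∈-allFin z) c∈)

  pathTo-candidate : ∀ x → pathTo x ∈ candidates
  pathTo-candidate x = candidate x (self-suffix (proj₁ (proj₂ (connected x r))))

  candidate-walk : ∀ {c} → c ∈ candidates → Pairs (Adj G) c × last c ≡ just r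
  candidate-walk c∈ with satisfied (∈-concatMap⁻ (λ z → suffixes (pathTo z)) {xs = allFin n} c∈)
  ... | z , c∈z = let _ , lt , _ , ps = proj₂ (connected z r) in
    suffix-pairs (pathTo z) c∈z ps , trans (suffix-last (pathTo z) c∈z) lt

  candidate-tail : ∀ {a b l} → (a ∷ b ∷ l) ∈ candidates → (b ∷ l) ∈ candidates
  candidate-tail c∈ with satisfied (∈-concatMap⁻ (λ z → suffixes (pathTo z)) {xs = allFin n} c∈)
  ... | z , c∈z = candidate z (suffix-tail (pathTo z) c∈z)

  startsAt : Fin n → List (Fin n) → Set
  startsAt x c = head c ≡ just x

  startsAt? : ∀ x c → Dec (startsAt x c)
  startsAt? x c = Maybe.≡-dec _≟_ (head c) (just x)

  best : Fin n → List (Fin n)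
  best x = argmin length (pathTo x) (filter (startsAt? x) candidates)

  best-candidate : ∀ x → best x ∈ candidates × startsAt x (best x)
  best-candidate x with argmin-sel length (pathTo x) (filter (startsAt? x) candidates)
  ... | inj₁ best≡path rewrite best≡path = pathTo-candidate x , proj₁ (proj₂ (connected x r))
  ... | inj₂ best∈ = ∈-filter⁻ (startsAt? x) best∈

  best-minimal : ∀ {x c} → c ∈ candidates → startsAt x c → length (best x) ≤ length c
  best-minimal {x} c∈ hd = f[argmin]≤v⁺ (pathTo x) _
    (inj₂ (lose (∈-filter⁺ (startsAt? x) c∈ hd) ≤-refl))

  second : List (Fin n) → Fin n
  second (a ∷ b ∷ _) = b
  second _ = r

  descend : ∀ {x} c → c ∈ candidates → startsAt x c → x ≢ r →
            Adj G x (second c) × length (best (second c)) < length c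
  descend (a ∷ []) c∈ refl a≢r = ⊥-elim (a≢r (just-injective (proj₂ (candidate-walk c∈))))
  descend (a ∷ b ∷ l) c∈ refl _ = proj₁ (proj₁ (candidate-walk c∈)) , s≤s (best-minimal (candidate-tail c∈) refl)

  parent-step : ∀ {x} → x ≢ r → Adj G x (second (best x)) × length (best (second (best x))) < length (best x)
  parent-step {x} = descend (best x) (proj₁ (best-candidate x)) (proj₂ (best-candidate x))

  rootedTree : RootedTree G r
  rootedTree = record
    { parent      = λ x → second (best x)
    ; rank        = λ x → length (best x)
    ; parent-adj  = λ x≢r → proj₁ (parent-step x≢r)
    ; rank-parent = λ x≢r → proj₂ (parent-step x≢r)
    }

next : Fin 3 → Fin 3
next zero = suc zero
next (suc zero) = suc (suc zero)
next (suc (suc zero)) = zero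

next-≢ : ∀ i → i ≢ next i
next-≢ zero ()
next-≢ (suc zero) ()
next-≢ (suc (suc zero)) ()

third : Fin 3 → Fin 3 → Fin 3
third zero zero = zero
third zero (suc zero) = suc (suc zero)
third zero (suc (suc zero)) = suc zero
third (suc zero) zero = suc (suc zero)
third (suc zero) (suc zero) = zero
third (suc zero) (suc (suc zero)) = zero
third (suc (suc zero)) zero = suc zero
third (suc (suc zero)) (suc zero) = zero
third (suc (suc zero)) (suc (suc zero)) = zero

third-sym : ∀ i j → third i j ≡ third j i
third-sym zero zero = refl
third-sym zero (suc zero) = refl
third-sym zero (suc (suc zero)) = refl
third-sym (suc zero) zero = refl
third-sym (suc zero) (suc zero) = refl
third-sym (suc zero) (suc (suc zero)) = refl
third-sym (suc (suc zero)) zero = refl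
third-sym (suc (suc zero)) (suc zero) = refl
third-sym (suc (suc zero)) (suc (suc zero)) = refl

ascending-triple : ∀ {i j k} → j ≡ next i → k ≡ next j →
                   third i j ≢ third j k × j ≢ third i j × j ≢ third j k
ascending-triple {zero} refl refl = (λ ()) , (λ ()) , (λ ())
ascending-triple {suc zero} refl refl = (λ ()) , (λ ()) , (λ ())
ascending-triple {suc (suc zero)} refl refl = (λ ()) , (λ ()) , (λ ())

module CyclicColouring {V : Set} (G : Graph V) (φ : V → Fin 3) where

  Ascending : V → V → Set
  Ascending u v = Adj G u v × φ v ≡ next (φ u)

  colouring : TotalColoring G 3
  colouring = record { vcol = φ ; ecol = λ u v → third (φ u) (φ v) ; ecolSym = λ u v → third-sym (φ u) (φ v) }

  ascending-triples : ∀ l → Pairs Ascending l →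
    Triples (λ a b d → third (φ a) (φ b) ≢ third (φ b) (φ d)
                     × φ b ≢ third (φ a) (φ b) × φ b ≢ third (φ b) (φ d)) l
  ascending-triples [] _ = _
  ascending-triples (a ∷ []) _ = _
  ascending-triples (a ∷ b ∷ []) _ = _
  ascending-triples (a ∷ b ∷ d ∷ l) ((_ , a→b) , b⇒d@(_ , b→d) , ps) =
    ascending-triple a→b b→d , ascending-triples (b ∷ d ∷ l) (b⇒d , ps)

  ascending-quads : ∀ l → Pairs Ascending l → Quads (λ a b d e → φ b ≢ φ d) l
  ascending-quads [] _ = _
  ascending-quads (a ∷ []) _ = _
  ascending-quads (a ∷ b ∷ []) _ = _
  ascending-quads (a ∷ b ∷ d ∷ []) _ = _
  ascending-quads (a ∷ b ∷ d ∷ e ∷ l) (_ , b⇒d@(_ , b→d) , ps) =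
    (λ φb≡φd → next-≢ (φ b) (trans φb≡φd b→d)) , ascending-quads (b ∷ d ∷ e ∷ l) (b⇒d , ps)

  total-proper-connected : DecidableEquality V → (∀ u v → Star Ascending u v) →
                           TotalProperConnected colouring
  total-proper-connected _≟V_ reach x y _ with LoopErasure.walk⇒path _≟V_ (reach x y)
  ... | l , hd , lt , u , ps =
    l , (hd , lt , u , pairs-map proj₁ l ps) , ascending-triples l ps , ascending-quads l ps

count : Bool → Bool → Fin 3
count false false = zero
count true false = suc zero
count false true = suc zero
count true true = suc (suc zero)

module StrongProduct {V W : Set} (_≟V_ : DecidableEquality V) (_≟W_ : DecidableEquality W)
                     {G : Graph V} {H : Graph W} {r : V} {s : W}
                     (S : RootedTree G r) (T : RootedTree H s)
                     {c : V} (c≢r : c ≢ r) {d : W} (d≢s : d ≢ s) where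

  module S = RootedTreeFacts _≟V_ S
  module T = RootedTreeFacts _≟W_ T

  colour : V × W → Fin 3
  colour (g , h) = count (S.side g) (T.side h)

  open CyclicColouring (G ⊠ H) colour

  _≈_ : V × W → V × W → Set
  u ≈ v = Star Ascending u v × Star Ascending v u

  ≈-refl : ∀ {u} → u ≈ u
  ≈-refl = ε , ε

  ≈-sym : ∀ {u v} → u ≈ v → v ≈ u
  ≈-sym (uv , vu) = vu , uv

  ≈-trans : ∀ {u v w} → u ≈ v → v ≈ w → u ≈ w
  ≈-trans (uv , vu) (vw , wv) = uv ◅◅ vw , wv ◅◅ vu

  ascending : ∀ {u v i} → Adj (G ⊠ H) u v → colour u ≡ i → colour v ≡ next i → Ascending u v
  ascending uv cu cv = uv , trans cv (cong next (sym cu))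

  -- The block {lo e, hi e} × {lo f, hi f} is a K4 coloured 0, 1, 1, 2 whose
  -- ascending edges 0 → 1 → 2 → 0 make it strongly connected.
  block : (e : AltEdge G S.side) (f : AltEdge H T.side) → ∀ {x y} → Ends e x → Ends f y →
          (x , y) ≈ (lo e , lo f)
  block e f = corner
    where
    c₀₀ : colour (lo e , lo f) ≡ zero
    c₀₀ = cong₂ count (lo-side e) (lo-side f)
    c₁₀ : colour (hi e , lo f) ≡ suc zero
    c₁₀ = cong₂ count (hi-side e) (lo-side f)
    c₀₁ : colour (lo e , hi f) ≡ suc zero
    c₀₁ = cong₂ count (lo-side e) (hi-side f)
    c₁₁ : colour (hi e , hi f) ≡ suc (suc zero)
    c₁₁ = cong₂ count (hi-side e) (hi-side f)

    00→10 : Ascending (lo e , lo f) (hi e , lo f)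
    00→10 = ascending (inj₁ (lo-hi e , refl)) c₀₀ c₁₀
    00→01 : Ascending (lo e , lo f) (lo e , hi f)
    00→01 = ascending (inj₂ (inj₁ (refl , lo-hi f))) c₀₀ c₀₁
    10→11 : Ascending (hi e , lo f) (hi e , hi f)
    10→11 = ascending (inj₂ (inj₁ (refl , lo-hi f))) c₁₀ c₁₁
    01→11 : Ascending (lo e , hi f) (hi e , hi f)
    01→11 = ascending (inj₁ (lo-hi e , refl)) c₀₁ c₁₁
    11→00 : Ascending (hi e , hi f) (lo e , lo f)
    11→00 = ascending (inj₂ (inj₂ (symAdj G (lo-hi e) , symAdj H (lo-hi f)))) c₁₁ c₀₀

    corner : ∀ {x y} → Ends e x → Ends f y → (x , y) ≈ (lo e , lo f)
    corner (inj₁ refl) (inj₁ refl) = ≈-refl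
    corner (inj₂ refl) (inj₁ refl) = 10→11 ◅ 11→00 ◅ ε , 00→10 ◅ ε
    corner (inj₁ refl) (inj₂ refl) = 01→11 ◅ 11→00 ◅ ε , 00→01 ◅ ε
    corner (inj₂ refl) (inj₂ refl) = 11→00 ◅ ε , 00→10 ◅ 10→11 ◅ ε

  across : ∀ e f {x x' y y'} → Ends e x → Ends e x' → Ends f y → Ends f y' → (x , y) ≈ (x' , y')
  across e f ex ex' fy fy' = ≈-trans (block e f ex fy) (≈-sym (block e f ex' fy'))

  -- Every vertex is equivalent to the vertex (r , s), passing through the
  -- root column: descend along tree edges of G, then of H, one block at a time.
  column : ∀ g h → (g , h) ≈ (r , h)
  column = S.induction (λ g → ∀ h → (g , h) ≈ (r , h)) (λ _ → ≈-refl) step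
    where
    step : ∀ g → g ≢ r → (∀ h → (RootedTree.parent S g , h) ≈ (r , h)) → ∀ h → (g , h) ≈ (r , h)
    step g g≢r ih h =
      let e , eg , ep = S.tree-edge g≢r
          f , fh = T.alt-edge-at d≢s h
      in ≈-trans (across e f eg ep fh fh) (ih h)

  row : ∀ h → (r , h) ≈ (r , s)
  row = T.induction (λ h → (r , h) ≈ (r , s)) ≈-refl step
    where
    step : ∀ h → h ≢ s → (r , RootedTree.parent T h) ≈ (r , s) → (r , h) ≈ (r , s)
    step h h≢s ih =
      let e , er = S.alt-edge-at c≢r r
          f , fh , fp = T.tree-edge h≢s
      in ≈-trans (across e f er er fh fp) ih

  strongly-connected : ∀ u v → Star Ascending u v
  strongly-connected (g , h) (g' , h') =
    proj₁ (≈-trans (column g h) (row h)) ◅◅ proj₂ (≈-trans (column g' h') (row h'))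

  tpc-colouring : TPCColorable (G ⊠ H) 3
  tpc-colouring = colouring , total-proper-connected (Product.≡-dec _≟V_ _≟W_) strongly-connected

no-three-distinct : ∀ {k} → k < 3 → (x y z : Fin k) → x ≢ y → y ≢ z → x ≢ z → ⊥
no-three-distinct {k} k<3 x y z x≢y y≢z x≢z with pigeonhole k<3 pick
  where
  pick : Fin 3 → Fin k
  pick zero = x
  pick (suc zero) = y
  pick (suc (suc zero)) = z
... | zero , suc zero , _ , x≡y = x≢y x≡y
... | zero , suc (suc zero) , _ , x≡z = x≢z x≡z
... | suc zero , suc (suc zero) , _ , y≡z = y≢z y≡z
... | zero , zero , () , _
... | suc zero , zero , () , _
... | suc zero , suc zero , s≤s () , _
... | suc (suc zero) , zero , () , _
... | suc (suc zero) , suc zero , s≤s () , _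
... | suc (suc zero) , suc (suc zero) , s≤s (s≤s ()) , _

-- A graph with a total-proper-connected colouring by fewer than three colours
-- is complete: a total proper path of length two or more would need three.
few-colours⇒complete : ∀ {V} (G : Graph V) {k} → k < 3 → TPCColorable G k → IsComplete G
few-colours⇒complete G k<3 (c , proper) u v u≢v with proper u v u≢v
... | [] , (() , _) , _
... | (a ∷ []) , (refl , refl , _) , _ = ⊥-elim (u≢v refl)
... | (a ∷ b ∷ []) , (refl , refl , _ , (ab , _)) , _ = ab
... | (a ∷ b ∷ d ∷ l) , _ , ((ab≢bd , b≢ab , b≢bd) , _) , _ = ⊥-elim (
  no-three-distinct k<3 (ecol c a b) (vcol c b) (ecol c b d) (λ ab≡b → b≢ab (sym ab≡b)) b≢bd ab≢bd)

theorem6p1 : (n m : ℕ) (G : Graph (Fin n)) (H : Graph (Fin m))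
    → 2 ≤ n → 2 ≤ m → Connected G → Connected H
    → ¬ IsComplete (G ⊠ H)
    → TpcIs (G ⊠ H) 3
theorem6p1 (suc (suc n)) (suc (suc m)) G H (s≤s (s≤s z≤n)) (s≤s (s≤s z≤n)) G-connected H-connected incomplete =
  StrongProduct.tpc-colouring _≟_ _≟_ treeG treeH one≢zero one≢zero ,
  λ k k<3 colouring → incomplete (few-colours⇒complete (G ⊠ H) k<3 colouring)
  where
  treeG : RootedTree G zero
  treeG = TreeConstruction.rootedTree G zero G-connected
  treeH : RootedTree H zero
  treeH = TreeConstruction.rootedTree H zero H-connected
  one≢zero : ∀ {k} → Fin.suc {suc k} Fin.zero ≢ Fin.zero
  one≢zero ()
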